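{- (i) Let $H$ be an Eulerian subgraph of an Eulerian graph $G$. If $c(H)<\nu(H)$, then $c(G)<\nu(G)$. (ii) Let $H'$ be a graph whose edge set decomposes into two edge-disjoint cycles that have more than two vertices in common. Then $c(H')=2$ and $\nu(H')\ge3$. In particular, an Eulerian graph $G$ containing two edge-disjoint cycles with more than two vertices in common satisfies $c(G)<\nu(G)$.
   Context: Graphs are finite, loopless, parallel edges allowed. A graph is Eulerian if it has a closed walk $v_0e_0\dots e_{k-1}v_k$, $v_0=v_k$, containing every edge exactly once. A cycle is a graph obtained from a path $u_0\dots u_k$ ($k\ge1$) by adding an edge $u_ku_0$ (two parallel edges form a cycle). A cycle decomposition of a graph is a set of cycle subgraphs such that every edge lies in exactly one; $c$ and $\nu$ denote the minimum and maximum number of cycles in a cycle decomposition. -}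

module Defs where

open import Data.Nat using (ℕ; zero; suc; _≤_; _<_)
open import Data.Fin using (Fin; inject₁; fromℕ)
open import Data.Fin.Subset using (Subset; _∈_; _∉_; _⊆_; ⊤)
open import Data.Fin.Subset.Properties using (∈⊤)
open import Data.List using (List; []; _∷_; length; lookup)
open import Data.List.Membership.Propositional using () renaming (_∈_ to _∈ₗ_)
open import Data.List.Relation.Unary.Unique.Propositional using (Unique)
open import Data.Product using (Σ; ∃; ∃-syntax; _×_; _,_)
open import Data.Sum using (_⊎_)
open import Function using (Injective)
open import Relation.Binary.PropositionalEquality using (_≡_; _≢_)
open import Function.Bundles using (_⇔_)

-- A finite loopless multigraph: vertices Fin nV, edges Fin nE, each edge
-- has two (distinct) endpoints; parallel edges are allowed.
record Graph : Set where
  field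
    nV : ℕ
    nE : ℕ
    end₁ : Fin nE → Fin nV
    end₂ : Fin nE → Fin nV
    loopless : ∀ e → end₁ e ≢ end₂ e
open Graph public

module _ (G : Graph) where

  Joins : Fin (nE G) → Fin (nV G) → Fin (nV G) → Set
  Joins e v w = (end₁ G e ≡ v × end₂ G e ≡ w) ⊎ (end₁ G e ≡ w × end₂ G e ≡ v)

  record Sub : Set where
    field
      V : Subset (nV G)
      E : Subset (nE G)
      closed : ∀ e → e ∈ E → (end₁ G e ∈ V) × (end₂ G e ∈ V)
  open Sub public

  full : Sub
  full = record { V = ⊤ ; E = ⊤ ; closed = λ _ _ → ∈⊤ , ∈⊤ }

  _≤S_ : Sub → Sub → Set
  S ≤S T = (V S ⊆ V T) × (E S ⊆ E T)

  data Walk : Fin (nV G) → Fin (nV G) → List (Fin (nE G)) → Set where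
    nil  : ∀ {v} → Walk v v []
    cons : ∀ {u v w e es} → Joins e u v → Walk v w es → Walk u w (e ∷ es)

  Eulerian : Sub → Set
  Eulerian S = Σ (Fin (nV G)) λ v → (v ∈ V S) × Σ (List (Fin (nE G))) λ es →
    Walk v v es × Unique es × (∀ e → (e ∈ E S) ⇔ (e ∈ₗ es))

  IsCycle : Sub → Set
  IsCycle S = Σ ℕ λ k → (1 ≤ k) ×
    Σ (Fin (suc k) → Fin (nV G)) λ u → Σ (Fin (suc k) → Fin (nE G)) λ ed →
      Injective _≡_ _≡_ u × Injective _≡_ _≡_ ed ×
      (∀ (i : Fin k) → Joins (ed (inject₁ i)) (u (inject₁ i)) (u (Fin.suc i))) ×
      Joins (ed (fromℕ k)) (u (fromℕ k)) (u Fin.zero) ×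
      (∀ v → (v ∈ V S) ⇔ (∃[ i ] u i ≡ v)) ×
      (∀ x → (x ∈ E S) ⇔ (∃[ i ] ed i ≡ x))

  -- a cycle decomposition of S: a collection of cycle subgraphs of S such
  -- that every edge of S lies in exactly one of them
  -- (the list has no repetitions automatically: cycles are nonempty and
  -- edge-disjoint)
  CycleDecomp : Sub → List Sub → Set
  CycleDecomp S D =
    (∀ i → IsCycle (lookup D i)) ×
    (∀ i → lookup D i ≤S S) ×
    (∀ e → e ∈ E S → Σ _ λ i → (e ∈ E (lookup D i)) ×
        (∀ j → e ∈ E (lookup D j) → j ≡ i))

  IsC : Sub → ℕ → Set
  IsC S k = (Σ (List Sub) λ D → CycleDecomp S D × length D ≡ k) ×
            (∀ D → CycleDecomp S D → k ≤ length D)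

  IsNu : Sub → ℕ → Set
  IsNu S k = (Σ (List Sub) λ D → CycleDecomp S D × length D ≡ k) ×
             (∀ D → CycleDecomp S D → length D ≤ k)

  CLtNu : Sub → Set
  CLtNu S = Σ ℕ λ a → Σ ℕ λ b → IsC S a × IsNu S b × a < b

  ShareMoreThanTwo : Sub → Sub → Set
  ShareMoreThanTwo C₁ C₂ = Σ (Fin (nV G)) λ x → Σ (Fin (nV G)) λ y → Σ (Fin (nV G)) λ z →
    x ≢ y × x ≢ z × y ≢ z ×
    (x ∈ V C₁) × (y ∈ V C₁) × (z ∈ V C₁) × (x ∈ V C₂) × (y ∈ V C₂) × (z ∈ V C₂)

  EdgeDisjoint : Sub → Sub → Set
  EdgeDisjoint C₁ C₂ = ∀ e → e ∈ E C₁ → e ∉ E C₂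

-- Edge sets are handled through degrees modulo 2 (exclusive-or sums of
-- incidences).  A path-growing argument finds a
-- cycle in every nonempty even set, so even sets have cycle decompositions,
-- and decompositions of disjoint sets combine.  Decompositions of T into n
-- cycles correspond to splittings of T into n minimal even sets, which are
-- decidable, so c and ν exist and two decompositions of different sizes
-- give c < ν.  (i) extends two decompositions of H by one of the rest of G.
-- (ii): cutting the two cycles at three common vertices pairs up their arcs
-- into three disjoint nonempty even sets, so at least three cycles; and a
-- single cycle cannot cover both, by minimality.

module Submission where

open import Algebra.Bundles using (CommutativeRing; CommutativeMonoid)
import Algebra.Properties.CommutativeSemigroup as CommSemigroupProps
open import Data.Bool using (Bool; true; false; _xor_; _∧_; _∨_)
import Data.Bool.Properties as BoolP
open import Data.Empty using (⊥-elim) renaming (⊥ to False)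
open import Data.Fin using (Fin; zero; suc; inject₁; inject≤; fromℕ; toℕ)
import Data.Fin.Properties as FinP
open import Data.Fin.Induction using (<-weakInduction)
open import Data.Fin.Subset using (Subset; _∈_; _∉_; _⊆_; ⊤; ⊥; _∪_; _─_; ⁅_⁆; Nonempty; Empty; ∣_∣)
import Data.Fin.Subset.Properties as SubP
open import Data.List as List using (List; []; _∷_; _++_; length)
open import Data.List.Membership.Propositional using () renaming (_∈_ to _∈ₗ_)
import Data.List.Membership.Propositional.Properties as ListMemP
import Data.List.Properties as ListP
open import Data.List.Relation.Binary.Permutation.Propositional using (_↭_; ↭-sym; ↭-trans; ↭-reflexive; ↭⇒↭ₛ; module PermutationReasoning)
import Data.List.Relation.Binary.Permutation.Propositional.Properties as PermP
import Data.List.Relation.Binary.Permutation.Setoid.Properties as PermSetoidP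
import Data.List.Relation.Unary.Unique.Propositional.Properties as UniqueP
open import Data.List.Relation.Unary.Any using (here; there)
import Data.List.Relation.Unary.All as All
import Data.List.Relation.Unary.AllPairs as AllPairs
open import Data.List.Relation.Unary.Unique.Propositional using (Unique)
open import Data.Nat using (ℕ; zero; suc; _≤_; _<_; z≤n; s≤s; _+_)
import Data.Nat.Properties as ℕP
open import Data.Product using (Σ; ∃; _×_; _,_; proj₁; proj₂)
open import Data.Sum using (_⊎_; inj₁; inj₂; [_,_]′; map₁; swap)
open import Data.Vec as Vec using (_∷_; lookup)
import Data.Vec.Properties as VecP
open import Function using (_∘_; Injective)
open import Function.Bundles using (Equivalence; mk⇔)
open import Relation.Nullary using (¬_; Dec; yes; no; does)
open import Relation.Nullary.Decidable using (_×-dec_; ¬?)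
open import Relation.Binary.PropositionalEquality
  using (_≡_; _≢_; refl; sym; trans; cong; cong₂; subst; subst₂; setoid; module ≡-Reasoning)

open import Defs

∈⇒lookup : ∀ {n} {p : Subset n} {x} → x ∈ p → lookup p x ≡ true
∈⇒lookup = VecP.[]=⇒lookup

lookup⇒∈ : ∀ {n} {p : Subset n} {x} → lookup p x ≡ true → x ∈ p
lookup⇒∈ {p = p} {x} = VecP.lookup⇒[]= x p

∉⇒lookup : ∀ {n} {p : Subset n} {x} → x ∉ p → lookup p x ≡ false
∉⇒lookup {p = p} {x} x∉p with lookup p x in eq
... | true  = ⊥-elim (x∉p (lookup⇒∈ eq))
... | false = refl

∈─⇒∉ : ∀ {n} (p q : Subset n) {x} → x ∈ p ─ q → x ∉ q
∈─⇒∉ (true ∷ p) (false ∷ q) Vec.here ()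
∈─⇒∉ (_ ∷ p) (_ ∷ q) (Vec.there x∈p─q) (Vec.there x∈q) = ∈─⇒∉ p q x∈p─q x∈q

⊕ : ∀ {n} → (Fin n → Bool) → Bool
⊕ {zero}  f = false
⊕ {suc n} f = f zero xor ⊕ (f ∘ suc)

⊕[_] : ∀ {n} → Subset n → (Fin n → Bool) → Bool
⊕[ p ] f = ⊕ (λ x → lookup p x ∧ f x)

xor-interchange : ∀ a b c d → (a xor b) xor (c xor d) ≡ (a xor c) xor (b xor d)
xor-interchange = CommSemigroupProps.interchange
  (CommutativeRing.+-commutativeSemigroup BoolP.xor-∧-commutativeRing)

⊕-cong : ∀ {n} {f g : Fin n → Bool} → (∀ x → f x ≡ g x) → ⊕ f ≡ ⊕ g
⊕-cong {zero}  f≡g = refl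
⊕-cong {suc n} f≡g = cong₂ _xor_ (f≡g zero) (⊕-cong (f≡g ∘ suc))

xor≡false⇒≡ : ∀ a b → a xor b ≡ false → a ≡ b
xor≡false⇒≡ true  true  _ = refl
xor≡false⇒≡ false false _ = refl

⊕-xor : ∀ {n} (f g : Fin n → Bool) → ⊕ (λ x → f x xor g x) ≡ ⊕ f xor ⊕ g
⊕-xor {zero}  f g = refl
⊕-xor {suc n} f g =
  trans (cong ((f zero xor g zero) xor_) (⊕-xor (f ∘ suc) (g ∘ suc)))
        (xor-interchange (f zero) (g zero) (⊕ (f ∘ suc)) (⊕ (g ∘ suc)))

⊕-false : ∀ {n} (f : Fin n → Bool) → (∀ x → f x ≡ false) → ⊕ f ≡ false
⊕-false {zero}  f f≡false = refl
⊕-false {suc n} f f≡false rewrite f≡false zero = ⊕-false (f ∘ suc) (f≡false ∘ suc)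

⊕-point : ∀ {n} (f : Fin n → Bool) a → (∀ x → x ≢ a → f x ≡ false) → ⊕ f ≡ f a
⊕-point {suc n} f zero vanish
  rewrite ⊕-false (f ∘ suc) (λ x → vanish (suc x) λ ()) = BoolP.xor-identityʳ (f zero)
⊕-point {suc n} f (suc a) vanish rewrite vanish zero (λ ()) =
  ⊕-point (f ∘ suc) a (λ x x≢a → vanish (suc x) (x≢a ∘ FinP.suc-injective))

⊕-witness : ∀ {n} (f : Fin n → Bool) → ⊕ f ≡ true → ∃ λ x → f x ≡ true
⊕-witness {suc n} f odd with f zero in f0
... | true  = zero , f0
... | false with ⊕-witness (f ∘ suc) odd
...   | x , fx = suc x , fx

⊕-∪ : ∀ {n} (p q : Subset n) f → (∀ x → x ∈ p → x ∉ q) →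
      ⊕[ p ∪ q ] f ≡ ⊕[ p ] f xor ⊕[ q ] f
⊕-∪ p q f disjoint =
  trans (⊕-cong pointwise) (⊕-xor (λ x → lookup p x ∧ f x) (λ x → lookup q x ∧ f x))
  where
  pointwise : ∀ x → lookup (p ∪ q) x ∧ f x ≡ (lookup p x ∧ f x) xor (lookup q x ∧ f x)
  pointwise x rewrite VecP.lookup-zipWith _∨_ x p q
    with lookup p x in px | lookup q x in qx
  ... | true  | true  = ⊥-elim (disjoint x (lookup⇒∈ px) (lookup⇒∈ qx))
  ... | true  | false = sym (BoolP.xor-identityʳ _)
  ... | false | _     = refl

⊕-empty : ∀ {n} f → ⊕[ ⊥ {n} ] f ≡ false
⊕-empty f = ⊕-false _ (λ x → cong (_∧ f x) (VecP.lookup-replicate x false))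

⊕[]-witness : ∀ {n} (p : Subset n) f → ⊕[ p ] f ≡ true → ∃ λ x → x ∈ p × f x ≡ true
⊕[]-witness p f odd with ⊕-witness _ odd
... | x , px∧fx with lookup p x in px | f x in fx
...   | true | true = x , lookup⇒∈ px , fx

⊕[]-cong : ∀ {n} (p : Subset n) {f g} → (∀ x → x ∈ p → f x ≡ g x) → ⊕[ p ] f ≡ ⊕[ p ] g
⊕[]-cong p {f} {g} f≡g = ⊕-cong pointwise
  where
  pointwise : ∀ x → lookup p x ∧ f x ≡ lookup p x ∧ g x
  pointwise x with lookup p x in px
  ... | true  = f≡g x (lookup⇒∈ px)
  ... | false = refl

⊕[]-xor : ∀ {n} (p : Subset n) f g →
          ⊕[ p ] (λ x → f x xor g x) ≡ ⊕[ p ] f xor ⊕[ p ] g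
⊕[]-xor p f g = trans (⊕-cong (λ x → BoolP.∧-distribˡ-xor (lookup p x) (f x) (g x)))
                      (⊕-xor (λ x → lookup p x ∧ f x) (λ x → lookup p x ∧ g x))

δ : ∀ {n} → Fin n → Fin n → Bool
δ a b = does (a FinP.≟ b)

δ-refl : ∀ {n} (a : Fin n) → δ a a ≡ true
δ-refl a with a FinP.≟ a
... | yes _   = refl
... | no a≢a = ⊥-elim (a≢a refl)

δ-≢ : ∀ {n} {a b : Fin n} → a ≢ b → δ a b ≡ false
δ-≢ {a = a} {b} a≢b with a FinP.≟ b
... | yes a≡b = ⊥-elim (a≢b a≡b)
... | no _    = refl

δ-true : ∀ {n} {a b : Fin n} → δ a b ≡ true → a ≡ b
δ-true {a = a} {b} δab with a FinP.≟ b
... | yes a≡b = a≡b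

δ-sym : ∀ {n} (a b : Fin n) → δ a b ≡ δ b a
δ-sym a b with a FinP.≟ b
... | yes refl = sym (δ-refl a)
... | no a≢b   = sym (δ-≢ (a≢b ∘ sym))

δ-injective : ∀ {m n} (f : Fin m → Fin n) → Injective _≡_ _≡_ f →
              ∀ a b → δ (f a) (f b) ≡ δ a b
δ-injective f f-inj a b with a FinP.≟ b
... | yes refl = δ-refl (f a)
... | no a≢b   = δ-≢ (a≢b ∘ f-inj)

⊕[]-δ : ∀ {n} (p : Subset n) a → ⊕[ p ] (δ a) ≡ lookup p a
⊕[]-δ p a = trans (⊕-point _ a off-a) (trans (cong (lookup p a ∧_) (δ-refl a)) (BoolP.∧-identityʳ _))
  where
  off-a : ∀ x → x ≢ a → lookup p x ∧ δ a x ≡ false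
  off-a x x≢a rewrite δ-≢ (x≢a ∘ sym) = BoolP.∧-zeroʳ _

⊕[]-singleton : ∀ {n} (a : Fin n) f → ⊕[ ⁅ a ⁆ ] f ≡ f a
⊕[]-singleton a f = trans (⊕-point _ a off-a) (cong (_∧ f a) (∈⇒lookup (SubP.x∈⁅x⁆ a)))
  where
  off-a : ∀ x → x ≢ a → lookup ⁅ a ⁆ x ∧ f x ≡ false
  off-a x x≢a rewrite ∉⇒lookup (SubP.x≢y⇒x∉⁅y⁆ x≢a) = refl

fromList : ∀ {n} → List (Fin n) → Subset n
fromList []       = ⊥
fromList (x ∷ xs) = ⁅ x ⁆ ∪ fromList xs

∈fromList⁺ : ∀ {n} {x : Fin n} xs → x ∈ₗ xs → x ∈ fromList xs
∈fromList⁺ (y ∷ ys) (here refl) = SubP.x∈p∪q⁺ (inj₁ (SubP.x∈⁅x⁆ y))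
∈fromList⁺ (y ∷ ys) (there x∈ys) = SubP.x∈p∪q⁺ (inj₂ (∈fromList⁺ ys x∈ys))

∈fromList⁻ : ∀ {n} {x : Fin n} xs → x ∈ fromList xs → x ∈ₗ xs
∈fromList⁻ []       x∈⊥ = ⊥-elim (SubP.∉⊥ x∈⊥)
∈fromList⁻ (y ∷ ys) x∈  with SubP.x∈p∪q⁻ ⁅ y ⁆ (fromList ys) x∈
... | inj₁ x∈⁅y⁆ = here (SubP.x∈⁅y⁆⇒x≡y y x∈⁅y⁆)
... | inj₂ x∈ys  = there (∈fromList⁻ ys x∈ys)

fromList-++ : ∀ {n} (xs ys : List (Fin n)) → fromList (xs ++ ys) ≡ fromList xs ∪ fromList ys
fromList-++ []       ys = sym (SubP.∪-identityˡ (fromList ys))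
fromList-++ (x ∷ xs) ys =
  trans (cong (⁅ x ⁆ ∪_) (fromList-++ xs ys)) (sym (SubP.∪-assoc ⁅ x ⁆ (fromList xs) (fromList ys)))

─-∪-cancel : ∀ {n} (p q : Subset n) → q ⊆ p → (p ─ q) ∪ q ≡ p
─-∪-cancel p q q⊆p = SubP.⊆-antisym
  (λ x∈ → [ SubP.p─q⊆p p q , q⊆p ]′ (SubP.x∈p∪q⁻ (p ─ q) q x∈))
  (λ {x} x∈p → SubP.x∈p∪q⁺ (removed-or-not x x∈p))
  where
  removed-or-not : ∀ x → x ∈ p → x ∈ p ─ q ⊎ x ∈ q
  removed-or-not x x∈p with x SubP.∈? q
  ... | yes x∈q = inj₂ x∈q
  ... | no x∉q  = inj₁ (SubP.x∈p∧x∉q⇒x∈p─q x∈p x∉q)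

unique-resp-↭ : ∀ {A : Set} {xs ys : List A} → xs ↭ ys → Unique xs → Unique ys
unique-resp-↭ {A} xs↭ys = PermSetoidP.Unique-resp-↭ (setoid A) (↭⇒↭ₛ xs↭ys)

unique-++⁻ : ∀ {A : Set} (xs : List A) {ys} → Unique (xs ++ ys) →
             Unique xs × Unique ys × (∀ {x} → x ∈ₗ xs → x ∈ₗ ys → False)
unique-++⁻ []       ys-unique = AllPairs.[] , ys-unique , λ ()
unique-++⁻ (x ∷ xs) (x∉ AllPairs.∷ rest-unique) with unique-++⁻ xs rest-unique
... | xs-unique , ys-unique , disjoint =
  (All.tabulate (All.lookup x∉ ∘ ListMemP.∈-++⁺ˡ) AllPairs.∷ xs-unique) ,
  ys-unique ,
  λ { (here refl) x∈ys → All.lookup x∉ (ListMemP.∈-++⁺ʳ xs x∈ys) refl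
    ; (there x∈xs) x∈ys → disjoint x∈xs x∈ys }

fromList-resp-↭ : ∀ {n} {xs ys : List (Fin n)} → xs ↭ ys → fromList xs ≡ fromList ys
fromList-resp-↭ {xs = xs} {ys} xs↭ys = SubP.⊆-antisym
  (λ x∈ → ∈fromList⁺ ys (PermP.∈-resp-↭ xs↭ys (∈fromList⁻ xs x∈)))
  (λ x∈ → ∈fromList⁺ xs (PermP.∈-resp-↭ (↭-sym xs↭ys) (∈fromList⁻ ys x∈)))

↭-interchange : ∀ {A : Set} (a b c d : List A) → (a ++ b) ++ (c ++ d) ↭ (a ++ c) ++ (b ++ d)
↭-interchange = CommSemigroupProps.interchange
  (CommutativeMonoid.commutativeSemigroup PermP.++-commutativeMonoid)

-- A trail (a walk without repeated edges) from a to b has odd degree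
-- exactly at its ends, so Eulerian edge sets are even.

module Parity (G : Graph) where

  Vertex : Set
  Vertex = Fin (nV G)

  Edge : Set
  Edge = Fin (nE G)

  EdgeSet : Set
  EdgeSet = Subset (nE G)

  -- whether v is an endpoint of e (e is not a loop)
  inc : Edge → Vertex → Bool
  inc e v = δ (end₁ G e) v xor δ (end₂ G e) v

  -- the boundary of a trail from a to b: its odd-degree vertices
  ends : Vertex → Vertex → Vertex → Bool
  ends a b v = δ a v xor δ b v

  deg : EdgeSet → Vertex → Bool
  deg T v = ⊕[ T ] (λ e → inc e v)

  Even : EdgeSet → Set
  Even T = ∀ v → deg T v ≡ false

  ends-comm : ∀ a b v → ends a b v ≡ ends b a v
  ends-comm a b v = BoolP.xor-comm (δ a v) (δ b v)

  ends-concat : ∀ a c b v → ends a c v xor ends c b v ≡ ends a b v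
  ends-concat a c b v = begin
    (δ a v xor δ c v) xor (δ c v xor δ b v) ≡⟨ BoolP.xor-assoc (δ a v) (δ c v) _ ⟩
    δ a v xor (δ c v xor (δ c v xor δ b v)) ≡⟨ cong (δ a v xor_) (sym (BoolP.xor-assoc (δ c v) (δ c v) (δ b v))) ⟩
    δ a v xor ((δ c v xor δ c v) xor δ b v) ≡⟨ cong (λ t → δ a v xor (t xor δ b v)) (BoolP.xor-same (δ c v)) ⟩
    δ a v xor δ b v                         ∎
    where open ≡-Reasoning

  joins-sym : ∀ {e a b} → Joins G e a b → Joins G e b a
  joins-sym (inj₁ ends-ab) = inj₂ ends-ab
  joins-sym (inj₂ ends-ba) = inj₁ ends-ba

  joins-≢ : ∀ {e a b} → Joins G e a b → a ≢ b
  joins-≢ (inj₁ (refl , refl)) = loopless G _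
  joins-≢ (inj₂ (refl , refl)) = loopless G _ ∘ sym

  joins-end : ∀ {e a b} → Joins G e a b → end₁ G e ≡ a ⊎ end₂ G e ≡ a
  joins-end (inj₁ (e₁≡a , _)) = inj₁ e₁≡a
  joins-end (inj₂ (_ , e₂≡a)) = inj₂ e₂≡a

  joins-ends : ∀ {P : Vertex → Set} {e a b} → Joins G e a b → P a → P b → P (end₁ G e) × P (end₂ G e)
  joins-ends (inj₁ (refl , refl)) Pa Pb = Pa , Pb
  joins-ends (inj₂ (refl , refl)) Pa Pb = Pb , Pa

  joins-inc : ∀ {e a b} → Joins G e a b → ∀ v → inc e v ≡ ends a b v
  joins-inc (inj₁ (refl , refl)) v = refl
  joins-inc {e} (inj₂ (refl , refl)) v = ends-comm (end₁ G e) (end₂ G e) v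

  ends-odd : ∀ {a b} → a ≢ b → ends a b a ≡ true
  ends-odd {a} {b} a≢b rewrite δ-refl a | δ-≢ (a≢b ∘ sym) = refl

  joins-incident : ∀ {e a b} → Joins G e a b → inc e a ≡ true
  joins-incident e-ab = trans (joins-inc e-ab _) (ends-odd (joins-≢ e-ab))

  incident-joins : ∀ e w → inc e w ≡ true → ∃ λ w′ → Joins G e w w′
  incident-joins e w e-at-w with end₁ G e FinP.≟ w | end₂ G e FinP.≟ w
  ... | yes e₁≡w | _       = end₂ G e , inj₁ (e₁≡w , refl)
  ... | no _     | yes e₂≡w = end₁ G e , inj₂ (refl , e₂≡w)

  deg-∪ : ∀ A B → (∀ e → e ∈ A → e ∉ B) → ∀ v → deg (A ∪ B) v ≡ deg A v xor deg B v
  deg-∪ A B disjoint v = ⊕-∪ A B (λ e → inc e v) disjoint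

  walk-deg : ∀ {a b es} → Walk G a b es → Unique es → ∀ v → deg (fromList es) v ≡ ends a b v
  walk-deg {a} nil _ v = trans (⊕-empty {nE G} (λ e → inc e v)) (sym (BoolP.xor-same (δ a v)))
  walk-deg {a} {b} (cons {v = c} {e = e} {es = es} e-ac rest) (e∉es AllPairs.∷ es-unique) v = begin
    deg (⁅ e ⁆ ∪ fromList es) v      ≡⟨ deg-∪ ⁅ e ⁆ (fromList es) disjoint v ⟩
    deg ⁅ e ⁆ v xor deg (fromList es) v ≡⟨ cong₂ _xor_ (⊕[]-singleton e _) (walk-deg rest es-unique v) ⟩
    inc e v xor ends c b v           ≡⟨ cong (_xor ends c b v) (joins-inc e-ac v) ⟩
    ends a c v xor ends c b v        ≡⟨ ends-concat a c b v ⟩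
    ends a b v                       ∎
    where
    open ≡-Reasoning
    disjoint : ∀ x → x ∈ ⁅ e ⁆ → x ∉ fromList es
    disjoint x x∈⁅e⁆ x∈es with SubP.x∈⁅y⁆⇒x≡y e x∈⁅e⁆
    ... | refl = All.lookup e∉es (∈fromList⁻ es x∈es) refl

  eulerian⇒even : ∀ S → Eulerian G S → Even (E {G} S)
  eulerian⇒even S (a , _ , es , tour , es-unique , edges) v =
    trans (cong (λ T → deg T v) E≡es) (trans (walk-deg tour es-unique v) (BoolP.xor-same (δ a v)))
    where
    E≡es : E {G} S ≡ fromList es
    E≡es = SubP.⊆-antisym (λ x∈S → ∈fromList⁺ es (Equivalence.to (edges _) x∈S))
                          (λ x∈es → Equivalence.from (edges _) (∈fromList⁻ es x∈es))

  even-∪ : ∀ A B → (∀ e → e ∈ A → e ∉ B) → Even A → Even B → Even (A ∪ B)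
  even-∪ A B disjoint A-even B-even v =
    trans (deg-∪ A B disjoint v) (cong₂ _xor_ (A-even v) (B-even v))

  even-─ : ∀ T U → U ⊆ T → Even T → Even U → Even (T ─ U)
  even-─ T U U⊆T T-even U-even v = begin
    deg (T ─ U) v                     ≡⟨ sym (BoolP.xor-identityʳ _) ⟩
    deg (T ─ U) v xor false           ≡⟨ cong (deg (T ─ U) v xor_) (sym (U-even v)) ⟩
    deg (T ─ U) v xor deg U v         ≡⟨ sym (deg-∪ (T ─ U) U (λ e e∈T─U → ∈─⇒∉ T U e∈T─U) v) ⟩
    deg ((T ─ U) ∪ U) v               ≡⟨ cong (λ X → deg X v) (─-∪-cancel T U U⊆T) ⟩
    deg T v                           ≡⟨ T-even v ⟩
    false                             ∎
    where open ≡-Reasoning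

  another-edge : ∀ T w a → Even T → a ∈ T → inc a w ≡ true →
                 Σ Edge λ b → b ∈ T × b ≢ a × inc b w ≡ true
  another-edge T w a T-even a∈T a-at-w = pick (⊕[]-witness T (λ b → inc b w xor δ a b) odd)
    where
    -- deg T w = 0 and a ∈ T, so T has an odd number of edges b with inc b w ≠ δ a b
    odd : ⊕[ T ] (λ b → inc b w xor δ a b) ≡ true
    odd = trans (⊕[]-xor T (λ b → inc b w) (δ a))
                (cong₂ _xor_ (T-even w) (trans (⊕[]-δ T a) (∈⇒lookup a∈T)))
    pick : (∃ λ b → b ∈ T × inc b w xor δ a b ≡ true) →
           Σ Edge λ b → b ∈ T × b ≢ a × inc b w ≡ true
    pick (b , b∈T , b-odd) with a FinP.≟ b
    ... | yes refl with trans (sym (cong (_xor true) a-at-w)) b-odd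
    ...   | ()
    pick (b , b∈T , b-odd) | no a≢b =
      b , b∈T , a≢b ∘ sym , trans (sym (BoolP.xor-identityʳ _)) b-odd

  boundary⇒nonempty : ∀ X a b → a ≢ b → (∀ v → deg X v ≡ ends a b v) → Nonempty X
  boundary⇒nonempty X a b a≢b X-deg with ⊕[]-witness X (λ e → inc e a) (trans (X-deg a) (ends-odd a≢b))
  ... | e , e∈X , _ = e , e∈X

module Walks (G : Graph) where
  open Parity G

  _++ʷ_ : ∀ {a b c es fs} → Walk G a b es → Walk G b c fs → Walk G a c (es ++ fs)
  nil          ++ʷ w = w
  cons e-ab w₁ ++ʷ w = cons e-ab (w₁ ++ʷ w)

  data Visits : ∀ {a b es} → Walk G a b es → Vertex → Set where
    start : ∀ {a b es} {w : Walk G a b es} → Visits w a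
    later : ∀ {a c b e es x} {e-ac : Joins G e a c} {w : Walk G c b es} →
            Visits w x → Visits (cons e-ac w) x

  visits-++ʷ : ∀ {a b c es fs x} (w₁ : Walk G a b es) (w₂ : Walk G b c fs) →
               Visits w₁ x ⊎ Visits w₂ x → Visits (w₁ ++ʷ w₂) x
  visits-++ʷ w₁           w₂ (inj₁ start)     = start
  visits-++ʷ (cons _ w₁)  w₂ (inj₁ (later v)) = later (visits-++ʷ w₁ w₂ (inj₁ v))
  visits-++ʷ nil          w₂ (inj₂ v)         = v
  visits-++ʷ (cons _ w₁)  w₂ (inj₂ v)         = later (visits-++ʷ w₁ w₂ (inj₂ v))

  record Cut {a b es} (w : Walk G a b es) (x : Vertex) : Set where
    field
      before after : List Edge
      es≡ : es ≡ before ++ after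
      walk₁ : Walk G a x before
      walk₂ : Walk G x b after
      visits : ∀ {y} → Visits w y → Visits walk₁ y ⊎ Visits walk₂ y

  cut : ∀ {a b es x} (w : Walk G a b es) → Visits w x → Cut w x
  cut w start = record
    { before = [] ; after = _ ; es≡ = refl ; walk₁ = nil ; walk₂ = w ; visits = inj₂ }
  cut (cons {e = e} e-ac w) (later x∈w) = record
    { before = e ∷ before ; after = after ; es≡ = cong (e ∷_) es≡
    ; walk₁ = cons e-ac walk₁ ; walk₂ = walk₂ ; visits = visits′ }
    where
    open Cut (cut w x∈w)
    visits′ : ∀ {y} → Visits (cons e-ac w) y → Visits (cons e-ac walk₁) y ⊎ Visits walk₂ y
    visits′ start = inj₁ start
    visits′ (later y∈w) = map₁ later (visits y∈w)

  Link : Vertex → Vertex → List Edge → Set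
  Link a b es = Walk G a b es ⊎ Walk G b a es

  link-deg : ∀ {a b es} → Link a b es → Unique es → ∀ v → deg (fromList es) v ≡ ends a b v
  link-deg (inj₁ w) es-unique v = walk-deg w es-unique v
  link-deg {a} {b} (inj₂ w) es-unique v = trans (walk-deg w es-unique v) (ends-comm b a v)

  record ThreeArcs (es : List Edge) (x y z : Vertex) : Set where
    field
      arc₁ arc₂ arc₃ : List Edge
      link₁ : Link x y arc₁
      link₂ : Link y z arc₂
      link₃ : Link z x arc₃
      arcs↭ : arc₁ ++ arc₂ ++ arc₃ ↭ es

  threeArcsFrom : ∀ {x y z es} (w : Walk G x x es) → Visits w y → Visits w z → ThreeArcs es x y z
  threeArcsFrom {x} {y} {z} {es} w y∈w z∈w with Cut.visits (cut w y∈w) z∈w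
  ... | inj₁ z∈r = record
    { arc₁ = s ; arc₂ = r₂ ; arc₃ = r₁
    ; link₁ = inj₂ (Cut.walk₂ y-cut) ; link₂ = inj₂ (Cut.walk₂ z-cut) ; link₃ = inj₂ (Cut.walk₁ z-cut)
    ; arcs↭ = begin
        s ++ r₂ ++ r₁  ↭⟨ PermP.++⁺ˡ s (PermP.++-comm r₂ r₁) ⟩
        s ++ r₁ ++ r₂  ≡⟨ cong (s ++_) (sym (Cut.es≡ z-cut)) ⟩
        s ++ r         ↭⟨ PermP.++-comm s r ⟩
        r ++ s         ≡⟨ sym (Cut.es≡ y-cut) ⟩
        es             ∎ }
    where
    open PermutationReasoning
    y-cut = cut w y∈w
    r = Cut.before y-cut
    s = Cut.after y-cut
    z-cut = cut (Cut.walk₁ y-cut) z∈r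
    r₁ = Cut.before z-cut
    r₂ = Cut.after z-cut
  ... | inj₂ z∈s = record
    { arc₁ = r ; arc₂ = s₁ ; arc₃ = s₂
    ; link₁ = inj₁ (Cut.walk₁ y-cut) ; link₂ = inj₁ (Cut.walk₁ z-cut) ; link₃ = inj₁ (Cut.walk₂ z-cut)
    ; arcs↭ = ↭-reflexive (sym (trans (Cut.es≡ y-cut) (cong (r ++_) (Cut.es≡ z-cut)))) }
    where
    y-cut = cut w y∈w
    r = Cut.before y-cut
    z-cut = cut (Cut.walk₂ y-cut) z∈s
    s₁ = Cut.before z-cut
    s₂ = Cut.after z-cut

  -- a closed walk through x, y and z, rotated to start at x
  threeArcs : ∀ {a x y z es} (w : Walk G a a es) → Visits w x → Visits w y → Visits w z →
              ThreeArcs es x y z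
  threeArcs {es = es} w x∈w y∈w z∈w = record
    { ThreeArcs rotated ; arcs↭ = ↭-trans (ThreeArcs.arcs↭ rotated) after++before↭es }
    where
    open Cut (cut w x∈w)
    rotation : Walk G _ _ (after ++ before)
    rotation = walk₂ ++ʷ walk₁
    onRotation : ∀ {v} → Visits w v → Visits rotation v
    onRotation v∈w = visits-++ʷ walk₂ walk₁ (swap (visits v∈w))
    rotated = threeArcsFrom rotation (onRotation y∈w) (onRotation z∈w)
    after++before↭es : after ++ before ↭ es
    after++before↭es = ↭-trans (PermP.++-comm after before) (↭-reflexive (sym es≡))

splitLast : ∀ {k} (i : Fin (suc k)) → (∃ λ j → i ≡ inject₁ j) ⊎ i ≡ fromℕ k
splitLast {zero}  zero    = inj₂ refl
splitLast {suc k} zero    = inj₁ (zero , refl)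
splitLast {suc k} (suc i) with splitLast i
... | inj₁ (j , refl) = inj₁ (suc j , refl)
... | inj₂ refl       = inj₂ refl

snoc : ∀ {k} {A : Set} → (Fin k → A) → A → Fin (suc k) → A
snoc {zero}  f a i       = a
snoc {suc k} f a zero    = f zero
snoc {suc k} f a (suc i) = snoc (f ∘ suc) a i

snoc-inject₁ : ∀ {k} {A : Set} (f : Fin k → A) a i → snoc f a (inject₁ i) ≡ f i
snoc-inject₁ {suc k} f a zero    = refl
snoc-inject₁ {suc k} f a (suc i) = snoc-inject₁ (f ∘ suc) a i

snoc-last : ∀ {k} {A : Set} (f : Fin k → A) a → snoc f a (fromℕ k) ≡ a
snoc-last {zero}  f a = refl
snoc-last {suc k} f a = snoc-last (f ∘ suc) a

snoc-injective : ∀ {k} {A : Set} (f : Fin k → A) a → Injective _≡_ _≡_ f → (∀ i → f i ≢ a) →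
                 Injective _≡_ _≡_ (snoc f a)
snoc-injective {k} f a f-inj a∉f {i} {j} eq with splitLast i | splitLast j
... | inj₁ (i′ , refl) | inj₁ (j′ , refl) =
  cong inject₁ (f-inj (trans (sym (snoc-inject₁ f a i′)) (trans eq (snoc-inject₁ f a j′))))
... | inj₁ (i′ , refl) | inj₂ refl =
  ⊥-elim (a∉f i′ (trans (sym (snoc-inject₁ f a i′)) (trans eq (snoc-last f a))))
... | inj₂ refl | inj₁ (j′ , refl) =
  ⊥-elim (a∉f j′ (trans (sym (snoc-inject₁ f a j′)) (trans (sym eq) (snoc-last f a))))
... | inj₂ refl | inj₂ refl = refl

image : ∀ {m n} → (Fin m → Fin n) → Subset n
image f = Vec.tabulate (λ x → does (FinP.any? (λ i → f i FinP.≟ x)))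

∈image⁺ : ∀ {m n} (f : Fin m → Fin n) i → f i ∈ image f
∈image⁺ f i = lookup⇒∈ (trans (VecP.lookup∘tabulate _ (f i)) hit)
  where
  hit : does (FinP.any? (λ j → f j FinP.≟ f i)) ≡ true
  hit with FinP.any? (λ j → f j FinP.≟ f i)
  ... | yes _   = refl
  ... | no none = ⊥-elim (none (i , refl))

∈image⁻ : ∀ {m n} (f : Fin m → Fin n) {x} → x ∈ image f → ∃ λ i → f i ≡ x
∈image⁻ f {x} x∈ = found (trans (sym (VecP.lookup∘tabulate _ x)) (∈⇒lookup x∈))
  where
  found : does (FinP.any? (λ j → f j FinP.≟ x)) ≡ true → ∃ λ i → f i ≡ x
  found hit with FinP.any? (λ j → f j FinP.≟ x)
  ... | yes witness = witness

-- Traversing a cycle gives a closed trail through all of its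
-- vertices, so its edge set is even; and a nonempty even subset of the
-- edges of a cycle is all of them (at each inner vertex u (j + 1) only the
-- edges ed j and ed (j + 1) meet).

module Cycles (G : Graph) where
  open Parity G
  open Walks G

  PathJoins : ∀ k → (Fin (suc k) → Vertex) → (Fin k → Edge) → Set
  PathJoins k u d = ∀ i → Joins G (d i) (u (inject₁ i)) (u (suc i))

  pathWalk : ∀ k (u : Fin (suc k) → Vertex) (d : Fin k → Edge) → PathJoins k u d →
             Walk G (u zero) (u (fromℕ k)) (List.tabulate d)
  pathWalk zero    u d joins = nil
  pathWalk (suc k) u d joins = cons (joins zero) (pathWalk k (u ∘ suc) (d ∘ suc) (joins ∘ suc))

  pathWalk-visits : ∀ k u d (joins : PathJoins k u d) i → Visits (pathWalk k u d joins) (u i)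
  pathWalk-visits k       u d joins zero    = start
  pathWalk-visits (suc k) u d joins (suc i) =
    later (pathWalk-visits k (u ∘ suc) (d ∘ suc) (joins ∘ suc) i)

  module Cycle {C : Sub G} (C-cycle : IsCycle G C) where

    k : ℕ
    k = proj₁ C-cycle

    u : Fin (suc k) → Vertex
    u = proj₁ (proj₂ (proj₂ C-cycle))

    ed : Fin (suc k) → Edge
    ed = proj₁ (proj₂ (proj₂ (proj₂ C-cycle)))

    private
      properties = proj₂ (proj₂ (proj₂ (proj₂ C-cycle)))

    u-injective : Injective _≡_ _≡_ u
    u-injective = proj₁ properties

    ed-injective : Injective _≡_ _≡_ ed
    ed-injective = proj₁ (proj₂ properties)

    path-joins : PathJoins k u (ed ∘ inject₁)
    path-joins = proj₁ (proj₂ (proj₂ properties))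

    closing-joins : Joins G (ed (fromℕ k)) (u (fromℕ k)) (u zero)
    closing-joins = proj₁ (proj₂ (proj₂ (proj₂ properties)))

    vertices : ∀ v → v ∈ V {G} C → ∃ λ i → u i ≡ v
    vertices v = Equivalence.to (proj₁ (proj₂ (proj₂ (proj₂ (proj₂ properties)))) v)

    edge-of : ∀ i → ed i ∈ E {G} C
    edge-of i = Equivalence.from (proj₂ (proj₂ (proj₂ (proj₂ (proj₂ properties)))) (ed i)) (i , refl)

    edge-index : ∀ {e} → e ∈ E {G} C → ∃ λ i → ed i ≡ e
    edge-index {e} = Equivalence.to (proj₂ (proj₂ (proj₂ (proj₂ (proj₂ properties)))) e)

    edgeList : List Edge
    edgeList = List.tabulate (ed ∘ inject₁) ++ ed (fromℕ k) ∷ []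

    walk : Walk G (u zero) (u zero) edgeList
    walk = pathWalk k u (ed ∘ inject₁) path-joins ++ʷ cons closing-joins nil

    edgeList-unique : Unique edgeList
    edgeList-unique = UniqueP.++⁺ (UniqueP.tabulate⁺ (FinP.inject₁-injective ∘ ed-injective))
                                  (All.[] AllPairs.∷ AllPairs.[]) distinct
      where
      distinct : ∀ {e} → ¬ (e ∈ₗ List.tabulate (ed ∘ inject₁) × e ∈ₗ ed (fromℕ k) ∷ [])
      distinct (e∈path , here refl) with ListMemP.∈-tabulate⁻ e∈path
      ... | i , eq = FinP.fromℕ≢inject₁ (ed-injective eq)

    edgeList-set : fromList edgeList ≡ E {G} C
    edgeList-set = SubP.⊆-antisym (from-list ∘ ∈fromList⁻ edgeList) (∈fromList⁺ edgeList ∘ to-list)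
      where
      from-list : ∀ {e} → e ∈ₗ edgeList → e ∈ E {G} C
      from-list e∈ with ListMemP.∈-++⁻ (List.tabulate (ed ∘ inject₁)) e∈
      ... | inj₁ e∈path with ListMemP.∈-tabulate⁻ e∈path
      ...   | j , refl = edge-of (inject₁ j)
      from-list e∈ | inj₂ (here refl) = edge-of (fromℕ k)
      to-list : ∀ {e} → e ∈ E {G} C → e ∈ₗ edgeList
      to-list e∈C with edge-index e∈C
      ... | i , refl with splitLast i
      ...   | inj₁ (j , refl) = ListMemP.∈-++⁺ˡ (ListMemP.∈-tabulate⁺ j)
      ...   | inj₂ refl       = ListMemP.∈-++⁺ʳ (List.tabulate (ed ∘ inject₁)) (here refl)

    visits : ∀ {v} → v ∈ V {G} C → Visits walk v
    visits {v} v∈C with vertices v v∈C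
    ... | i , refl = visits-++ʷ (pathWalk k u (ed ∘ inject₁) path-joins) _
                                (inj₁ (pathWalk-visits k u (ed ∘ inject₁) path-joins i))

    even : Even (E {G} C)
    even v = begin
      deg (E {G} C) v             ≡⟨ cong (λ T → deg T v) (sym edgeList-set) ⟩
      deg (fromList edgeList) v   ≡⟨ walk-deg walk edgeList-unique v ⟩
      ends (u zero) (u zero) v    ≡⟨ BoolP.xor-same (δ (u zero) v) ⟩
      false                       ∎
      where open ≡-Reasoning

    nonempty : Nonempty (E {G} C)
    nonempty = ed zero , edge-of zero

    vertex-endpoint : ∀ {v} → v ∈ V {G} C → ∃ λ e → e ∈ E {G} C × (end₁ G e ≡ v ⊎ end₂ G e ≡ v)
    vertex-endpoint {v} v∈C with vertices v v∈C
    ... | i , refl with splitLast i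
    ...   | inj₁ (j , refl) = ed (inject₁ j) , edge-of _ , joins-end (path-joins j)
    ...   | inj₂ refl       = ed (fromℕ k) , edge-of _ , joins-end closing-joins

    inner-inc : ∀ j m → inc (ed m) (u (suc j)) ≡ δ (inject₁ j) m xor δ (suc j) m
    inner-inc j m with splitLast m
    ... | inj₁ (i , refl) = begin
      inc (ed (inject₁ i)) (u (suc j))                            ≡⟨ joins-inc (path-joins i) _ ⟩
      δ (u (inject₁ i)) (u (suc j)) xor δ (u (suc i)) (u (suc j)) ≡⟨ cong₂ _xor_ (δ-injective u u-injective _ _) (δ-injective u u-injective _ _) ⟩
      δ (inject₁ i) (suc j) xor δ (suc i) (suc j)                 ≡⟨ cong₂ _xor_ (δ-sym (inject₁ i) (suc j)) same-step ⟩
      δ (suc j) (inject₁ i) xor δ (inject₁ j) (inject₁ i)         ≡⟨ BoolP.xor-comm (δ (suc j) (inject₁ i)) _ ⟩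
      δ (inject₁ j) (inject₁ i) xor δ (suc j) (inject₁ i)         ∎
      where
      open ≡-Reasoning
      same-step : δ (suc i) (suc j) ≡ δ (inject₁ j) (inject₁ i)
      same-step = trans (δ-injective suc FinP.suc-injective i j)
                        (trans (δ-sym i j) (sym (δ-injective inject₁ FinP.inject₁-injective j i)))
    ... | inj₂ refl = begin
      inc (ed (fromℕ k)) (u (suc j))                              ≡⟨ joins-inc closing-joins _ ⟩
      δ (u (fromℕ k)) (u (suc j)) xor δ (u zero) (u (suc j))      ≡⟨ cong₂ _xor_ (δ-injective u u-injective _ _) (δ-injective u u-injective _ _) ⟩
      δ (fromℕ k) (suc j) xor false                               ≡⟨ BoolP.xor-identityʳ _ ⟩
      δ (fromℕ k) (suc j)                                         ≡⟨ δ-sym (fromℕ k) (suc j) ⟩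
      δ (suc j) (fromℕ k)                                         ≡⟨ cong (_xor δ (suc j) (fromℕ k)) (sym (δ-≢ {a = inject₁ j} (FinP.fromℕ≢inject₁ ∘ sym))) ⟩
      δ (inject₁ j) (fromℕ k) xor δ (suc j) (fromℕ k)             ∎
      where open ≡-Reasoning

    inner-deg : ∀ T → T ⊆ E {G} C → ∀ j →
                deg T (u (suc j)) ≡ lookup T (ed (inject₁ j)) xor lookup T (ed (suc j))
    inner-deg T T⊆C j = begin
      ⊕[ T ] (λ e → inc e (u (suc j)))                         ≡⟨ ⊕[]-cong T inc-at ⟩
      ⊕[ T ] (λ e → δ (ed (inject₁ j)) e xor δ (ed (suc j)) e) ≡⟨ ⊕[]-xor T _ _ ⟩
      ⊕[ T ] (δ (ed (inject₁ j))) xor ⊕[ T ] (δ (ed (suc j)))  ≡⟨ cong₂ _xor_ (⊕[]-δ T _) (⊕[]-δ T _) ⟩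
      lookup T (ed (inject₁ j)) xor lookup T (ed (suc j))      ∎
      where
      open ≡-Reasoning
      inc-at : ∀ e → e ∈ T → inc e (u (suc j)) ≡ δ (ed (inject₁ j)) e xor δ (ed (suc j)) e
      inc-at e e∈T with edge-index (T⊆C e∈T)
      ... | m , refl = trans (inner-inc j m)
        (sym (cong₂ _xor_ (δ-injective ed ed-injective _ m) (δ-injective ed ed-injective _ m)))

    minimal : ∀ T → T ⊆ E {G} C → Nonempty T → Even T → E {G} C ⊆ T
    minimal T T⊆C (t , t∈T) T-even e∈C with edge-index (T⊆C t∈T) | edge-index e∈C
    ... | i , refl | m , refl = lookup⇒∈ (trans (sym (constant m)) (trans (constant i) (∈⇒lookup t∈T)))
      where
      constant : ∀ m → lookup T (ed zero) ≡ lookup T (ed m)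
      constant = <-weakInduction (λ m → lookup T (ed zero) ≡ lookup T (ed m)) refl
        (λ j same → trans same (xor≡false⇒≡ _ _ (trans (sym (inner-deg T T⊆C j)) (T-even (u (suc j))))))

  closePath : ∀ k → 1 ≤ k → (u : Fin (suc k) → Vertex) → Injective _≡_ _≡_ u →
              (d : Fin k → Edge) → Injective _≡_ _≡_ d → PathJoins k u d →
              (c : Edge) → Joins G c (u (fromℕ k)) (u zero) → (∀ i → d i ≢ c) →
              Σ (Sub G) λ C → IsCycle G C × (∀ {x} → x ∈ E {G} C → (∃ λ i → d i ≡ x) ⊎ x ≡ c)
  closePath k 1≤k u u-inj d d-inj joins c c-joins c-fresh = C , C-cycle , C-edges
    where
    ed : Fin (suc k) → Edge
    ed = snoc d c

    ends-in-image : ∀ e → e ∈ image ed → (end₁ G e ∈ image u) × (end₂ G e ∈ image u)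
    ends-in-image e e∈ with ∈image⁻ ed e∈
    ... | i , refl with splitLast i
    ...   | inj₁ (j , refl) rewrite snoc-inject₁ d c j = joins-ends {P = _∈ image u} (joins j) (∈image⁺ u _) (∈image⁺ u _)
    ...   | inj₂ refl       rewrite snoc-last d c     = joins-ends {P = _∈ image u} c-joins (∈image⁺ u _) (∈image⁺ u _)

    C : Sub G
    C = record { V = image u ; E = image ed ; closed = ends-in-image }

    C-cycle : IsCycle G C
    C-cycle = k , 1≤k , u , ed , u-inj , snoc-injective d c d-inj c-fresh ,
      (λ i → subst (λ e → Joins G e (u (inject₁ i)) (u (suc i))) (sym (snoc-inject₁ d c i)) (joins i)) ,
      subst (λ e → Joins G e (u (fromℕ k)) (u zero)) (sym (snoc-last d c)) c-joins ,
      (λ v → mk⇔ (∈image⁻ u) (λ { (i , refl) → ∈image⁺ u i })) ,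
      (λ x → mk⇔ (∈image⁻ ed) (λ { (i , refl) → ∈image⁺ ed i }))

    C-edges : ∀ {x} → x ∈ image ed → (∃ λ i → d i ≡ x) ⊎ x ≡ c
    C-edges x∈ with ∈image⁻ ed x∈
    ... | i , refl with splitLast i
    ...   | inj₁ (j , refl) = inj₁ (j , sym (snoc-inject₁ d c j))
    ...   | inj₂ refl       = inj₂ (snoc-last d c)

-- Start
-- with a path consisting of one edge of T and grow it at its first vertex
-- w: since deg T w is even, a second edge of T leaves w.  Either it leads
-- back to the path, closing a cycle, or to a new vertex, lengthening the
-- path.  Paths have distinct vertices, so the growth stops.

module FindCycle (G : Graph) where
  open Parity G
  open Cycles G

  CycleIn : EdgeSet → Set
  CycleIn T = Σ (Sub G) λ C → IsCycle G C × E {G} C ⊆ T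

  -- a path u 0 … u (k + 1) of k + 1 edges of T
  record Path (T : EdgeSet) : Set where
    field
      k : ℕ
      u : Fin (suc (suc k)) → Vertex
      d : Fin (suc k) → Edge
      u-injective : Injective _≡_ _≡_ u
      d-injective : Injective _≡_ _≡_ d
      joins : PathJoins (suc k) u d
      d∈T : ∀ i → d i ∈ T

  module Grow {T : EdgeSet} (T-even : Even T) (p : Path T) where
    open Path p

    private
      second = another-edge T (u zero) (d zero) T-even (d∈T zero) (joins-incident (joins zero))

    e′ : Edge
    e′ = proj₁ second

    e′∈T : e′ ∈ T
    e′∈T = proj₁ (proj₂ second)

    e′≢d₀ : e′ ≢ d zero
    e′≢d₀ = proj₁ (proj₂ (proj₂ second))

    e′-at-start : inc e′ (u zero) ≡ true
    e′-at-start = proj₂ (proj₂ (proj₂ second))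

    w′ : Vertex
    w′ = proj₁ (incident-joins e′ (u zero) e′-at-start)

    e′-joins : Joins G e′ (u zero) w′
    e′-joins = proj₂ (incident-joins e′ (u zero) e′-at-start)

    at-start : ∀ j → inc (d j) (u zero) ≡ true → j ≡ zero
    at-start j meets = first-index j (δ-true (begin
      δ (inject₁ j) zero                                   ≡⟨ sym (BoolP.xor-identityʳ _) ⟩
      δ (inject₁ j) zero xor δ (suc j) zero                ≡⟨ sym (cong₂ _xor_ (δ-injective u u-injective _ _) (δ-injective u u-injective _ _)) ⟩
      δ (u (inject₁ j)) (u zero) xor δ (u (suc j)) (u zero) ≡⟨ sym (joins-inc (joins j) (u zero)) ⟩
      inc (d j) (u zero)                                   ≡⟨ meets ⟩
      true                                                 ∎))
      where
      open ≡-Reasoning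
      first-index : ∀ (j : Fin (suc k)) → inject₁ j ≡ zero → j ≡ zero
      first-index zero    _ = refl

    e′-fresh : ∀ j → d j ≢ e′
    e′-fresh j dj≡e′ with at-start j (subst (λ e → inc e (u zero) ≡ true) (sym dj≡e′) e′-at-start)
    ... | refl = e′≢d₀ (sym dj≡e′)

    closeAt : ∀ m → u (suc m) ≡ w′ → CycleIn T
    closeAt m u≡w′ = C , C-cycle , C⊆T
      where
      kc = suc (toℕ m)
      kc+1≤k+2 : suc kc ≤ suc (suc k)
      kc+1≤k+2 = FinP.toℕ<n (suc m)
      kc≤k+1 : kc ≤ suc k
      kc≤k+1 = FinP.toℕ<n m
      uc : Fin (suc kc) → Vertex
      uc i = u (inject≤ i kc+1≤k+2)
      dc : Fin kc → Edge
      dc i = d (inject≤ i kc≤k+1)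
      u-at : ∀ {i j} → toℕ i ≡ toℕ j → u i ≡ u j
      u-at = cong u ∘ FinP.toℕ-injective
      prefix-joins : PathJoins kc uc dc
      prefix-joins i = subst₂ (Joins G (dc i))
        (u-at (begin
          toℕ (inject₁ (inject≤ i kc≤k+1)) ≡⟨ FinP.toℕ-inject₁ _ ⟩
          toℕ (inject≤ i kc≤k+1)           ≡⟨ FinP.toℕ-inject≤ i _ ⟩
          toℕ i                                     ≡⟨ sym (FinP.toℕ-inject₁ i) ⟩
          toℕ (inject₁ i)                           ≡⟨ sym (FinP.toℕ-inject≤ (inject₁ i) _) ⟩
          toℕ (inject≤ (inject₁ i) kc+1≤k+2) ∎))
        (u-at (trans (cong suc (FinP.toℕ-inject≤ i kc≤k+1)) (sym (FinP.toℕ-inject≤ (suc i) kc+1≤k+2))))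
        (joins (inject≤ i kc≤k+1))
        where open ≡-Reasoning
      closing-joins : Joins G e′ (uc (fromℕ kc)) (uc zero)
      closing-joins = subst (λ v → Joins G e′ v (u zero))
        (trans (sym u≡w′) (u-at (trans (sym (FinP.toℕ-fromℕ kc)) (sym (FinP.toℕ-inject≤ (fromℕ kc) kc+1≤k+2)))))
        (joins-sym e′-joins)
      cycle = closePath kc (s≤s z≤n) uc (FinP.inject≤-injective _ _ _ _ ∘ u-injective)
                dc (FinP.inject≤-injective _ _ _ _ ∘ d-injective) prefix-joins e′ closing-joins (λ i → e′-fresh _)
      C = proj₁ cycle
      C-cycle = proj₁ (proj₂ cycle)
      C⊆T : E {G} C ⊆ T
      C⊆T e∈C with proj₂ (proj₂ cycle) e∈C
      ... | inj₁ (i , refl) = d∈T _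
      ... | inj₂ refl       = e′∈T

    extend : (∀ i → u i ≢ w′) → Path T
    extend w′-new = record
      { k = suc k ; u = u′ ; d = d′ ; u-injective = u′-injective ; d-injective = d′-injective
      ; joins = joins′ ; d∈T = d′∈T }
      where
      u′ : Fin (suc (suc (suc k))) → Vertex
      u′ zero    = w′
      u′ (suc i) = u i
      u′-injective : Injective _≡_ _≡_ u′
      u′-injective {zero}  {zero}  _  = refl
      u′-injective {zero}  {suc j} eq = ⊥-elim (w′-new j (sym eq))
      u′-injective {suc i} {zero}  eq = ⊥-elim (w′-new i eq)
      u′-injective {suc i} {suc j} eq = cong suc (u-injective eq)
      d′ : Fin (suc (suc k)) → Edge
      d′ zero    = e′
      d′ (suc i) = d i
      d′-injective : Injective _≡_ _≡_ d′
      d′-injective {zero}  {zero}  _  = refl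
      d′-injective {zero}  {suc j} eq = ⊥-elim (e′-fresh j (sym eq))
      d′-injective {suc i} {zero}  eq = ⊥-elim (e′-fresh i eq)
      d′-injective {suc i} {suc j} eq = cong suc (d-injective eq)
      joins′ : PathJoins (suc (suc k)) u′ d′
      joins′ zero    = joins-sym e′-joins
      joins′ (suc i) = joins i
      d′∈T : ∀ i → d′ i ∈ T
      d′∈T zero    = e′∈T
      d′∈T (suc i) = d∈T i

    grow : CycleIn T ⊎ Σ (Path T) λ p′ → Path.k p′ ≡ suc k
    grow with FinP.any? (λ i → u i FinP.≟ w′)
    ... | yes (zero  , u₀≡w′) = ⊥-elim (joins-≢ e′-joins u₀≡w′)
    ... | yes (suc m , u≡w′)  = inj₁ (closeAt m u≡w′)
    ... | no w′-new           = inj₂ (extend (λ i u≡w′ → w′-new (i , u≡w′)) , refl)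

  -- growing paths, with fuel f bounding the remaining number of steps
  findFrom : ∀ {T} → Even T → (f : ℕ) (p : Path T) → nV G ≤ f + suc (suc (Path.k p)) → CycleIn T
  findFrom T-even f p bound with Grow.grow T-even p
  ... | inj₁ cycle = cycle
  findFrom T-even zero    p bound | inj₂ (p′ , refl) =
    ⊥-elim (ℕP.n≮n _ (ℕP.≤-trans (FinP.injective⇒≤ (Path.u-injective p′)) bound))
  findFrom T-even (suc f) p bound | inj₂ (p′ , refl) =
    findFrom T-even f p′ (subst (nV G ≤_) (sym (ℕP.+-suc f _)) bound)

  findCycle : ∀ T → Even T → Nonempty T → CycleIn T
  findCycle T T-even (e , e∈T) = findFrom T-even (nV G) edgePath (ℕP.m≤m+n _ _)
    where
    u₀ : Fin 2 → Vertex
    u₀ zero       = end₁ G e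
    u₀ (suc zero) = end₂ G e
    u₀-injective : Injective _≡_ _≡_ u₀
    u₀-injective {zero}     {zero}     _  = refl
    u₀-injective {zero}     {suc zero} eq = ⊥-elim (loopless G e eq)
    u₀-injective {suc zero} {zero}     eq = ⊥-elim (loopless G e (sym eq))
    u₀-injective {suc zero} {suc zero} _  = refl
    edgePath : Path T
    edgePath = record
      { k = 0 ; u = u₀ ; d = λ _ → e ; u-injective = u₀-injective
      ; d-injective = λ { {zero} {zero} _ → refl } ; joins = λ { zero → inj₁ (refl , refl) }
      ; d∈T = λ _ → e∈T }

-- Every even set has one (repeatedly remove a cycle found by
-- findCycle; what remains is still even), decompositions of disjoint sets
-- combine, and they are exactly the cycle decompositions of Defs.

module Decompositions (G : Graph) where
  open Parity G
  open Cycles G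
  open FindCycle G

  data Decomp : EdgeSet → List (Sub G) → Set where
    done : ∀ {T} → Empty T → Decomp T []
    peel : ∀ {T C D} → IsCycle G C → E {G} C ⊆ T → Decomp (T ─ E {G} C) D → Decomp T (C ∷ D)

  decompose-within : (f : ℕ) → ∀ T → ∣ T ∣ < f → Even T → Σ (List (Sub G)) (Decomp T)
  decompose-within (suc f) T (s≤s size) T-even with SubP.nonempty? T
  ... | no T-empty = [] , done T-empty
  ... | yes T-nonempty with findCycle T T-even T-nonempty
  ...   | C , C-cycle , C⊆T with decompose-within f (T ─ E {G} C) smaller rest-even
    where
    open Cycle {C} C-cycle using (nonempty; even)
    smaller : ∣ T ─ E {G} C ∣ < f
    smaller = ℕP.<-≤-trans (SubP.p∩q≢∅⇒∣p─q∣<∣p∣ T (E {G} C)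
                (proj₁ nonempty , SubP.x∈p∩q⁺ (C⊆T (proj₂ nonempty) , proj₂ nonempty))) size
    rest-even : Even (T ─ E {G} C)
    rest-even = even-─ T (E {G} C) C⊆T T-even even
  ...     | D , D-decomp = C ∷ D , peel C-cycle C⊆T D-decomp

  decompose : ∀ T → Even T → Σ (List (Sub G)) (Decomp T)
  decompose T = decompose-within (suc ∣ T ∣) T ℕP.≤-refl

  AtLeast : ℕ → EdgeSet → Set
  AtLeast k T = Σ (List (Sub G)) λ D → Decomp T D × k ≤ length D

  atLeast-resp : ∀ {k T T′} → T ≡ T′ → AtLeast k T → AtLeast k T′
  atLeast-resp refl many = many

  decompose-nonempty : ∀ T → Even T → Nonempty T → AtLeast 1 T
  decompose-nonempty T T-even T-nonempty with decompose T T-even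
  ... | [] , done T-empty = ⊥-elim (T-empty T-nonempty)
  ... | C ∷ D , D-decomp  = C ∷ D , D-decomp , s≤s z≤n

  decomp-∪ : ∀ {T T′ D D′} → Decomp T D → Decomp T′ D′ → (∀ e → e ∈ T → e ∉ T′) →
             Decomp (T ∪ T′) (D ++ D′)
  decomp-∪ {T} {T′} {D′ = D′} (done T-empty) D′-decomp _ =
    subst (λ X → Decomp X D′) (sym (trans (cong (_∪ T′) (SubP.Empty-unique T-empty)) (SubP.∪-identityˡ T′))) D′-decomp
  decomp-∪ {T} {T′} (peel {C = C} C-cycle C⊆T D-decomp) D′-decomp disjoint =
    peel C-cycle (SubP.p⊆p∪q T′ ∘ C⊆T)
         (subst (λ X → Decomp X _) peel-∪ (decomp-∪ D-decomp D′-decomp (λ e e∈ → disjoint e (SubP.p─q⊆p T _ e∈))))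
    where
    peel-∪ : (T ─ E {G} C) ∪ T′ ≡ (T ∪ T′) ─ E {G} C
    peel-∪ = SubP.⊆-antisym to from
      where
      to : (T ─ E {G} C) ∪ T′ ⊆ (T ∪ T′) ─ E {G} C
      to e∈ with SubP.x∈p∪q⁻ (T ─ E {G} C) T′ e∈
      ... | inj₁ e∈T─C = SubP.x∈p∧x∉q⇒x∈p─q (SubP.p⊆p∪q T′ (SubP.p─q⊆p T _ e∈T─C)) (∈─⇒∉ T _ e∈T─C)
      ... | inj₂ e∈T′  = SubP.x∈p∧x∉q⇒x∈p─q (SubP.q⊆p∪q T T′ e∈T′) (λ e∈C → disjoint _ (C⊆T e∈C) e∈T′)
      from : (T ∪ T′) ─ E {G} C ⊆ (T ─ E {G} C) ∪ T′
      from e∈ with SubP.x∈p∪q⁻ T T′ (SubP.p─q⊆p (T ∪ T′) _ e∈)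
      ... | inj₁ e∈T  = SubP.p⊆p∪q T′ (SubP.x∈p∧x∉q⇒x∈p─q e∈T (∈─⇒∉ (T ∪ T′) _ e∈))
      ... | inj₂ e∈T′ = SubP.q⊆p∪q _ T′ e∈T′

  decomp-cycles : ∀ {T D} → Decomp T D → ∀ i → IsCycle G (List.lookup D i)
  decomp-cycles (peel C-cycle _ _) zero    = C-cycle
  decomp-cycles (peel _ _ D-decomp) (suc i) = decomp-cycles D-decomp i

  decomp-⊆ : ∀ {T D} → Decomp T D → ∀ i → E {G} (List.lookup D i) ⊆ T
  decomp-⊆ (peel _ C⊆T _)      zero    = C⊆T
  decomp-⊆ {T} (peel _ _ D-decomp) (suc i) = SubP.p─q⊆p T _ ∘ decomp-⊆ D-decomp i

  decomp-covers : ∀ {T D} → Decomp T D → ∀ e → e ∈ T →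
                  Σ _ λ i → e ∈ E {G} (List.lookup D i) × (∀ j → e ∈ E {G} (List.lookup D j) → j ≡ i)
  decomp-covers (done T-empty) e e∈T = ⊥-elim (T-empty (e , e∈T))
  decomp-covers {T} (peel {C = C} {D = D} _ _ D-decomp) e e∈T with e SubP.∈? E {G} C
  ... | yes e∈C = zero , e∈C , only-first
    where
    only-first : ∀ j → e ∈ E {G} (List.lookup (C ∷ D) j) → j ≡ zero
    only-first zero    _      = refl
    only-first (suc j) e∈Cⱼ   = ⊥-elim (∈─⇒∉ T (E {G} C) (decomp-⊆ D-decomp j e∈Cⱼ) e∈C)
  ... | no e∉C with decomp-covers D-decomp e (SubP.x∈p∧x∉q⇒x∈p─q e∈T e∉C)
  ...   | i , e∈Cᵢ , unique = suc i , e∈Cᵢ , only-later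
    where
    only-later : ∀ j → e ∈ E {G} (List.lookup (C ∷ D) j) → j ≡ suc i
    only-later zero    e∈C′ = ⊥-elim (e∉C e∈C′)
    only-later (suc j) e∈Cⱼ = cong suc (unique j e∈Cⱼ)

  toCycleDecomp : ∀ (S : Sub G) {D} → Decomp (E {G} S) D → CycleDecomp G S D
  toCycleDecomp S {D} D-decomp =
    decomp-cycles D-decomp , (λ i → vertices-in i , decomp-⊆ D-decomp i) , decomp-covers D-decomp
    where
    -- a vertex of a cycle is an endpoint of one of its edges, which lie in S
    vertices-in : ∀ i → V {G} (List.lookup D i) ⊆ V {G} S
    vertices-in i v∈Cᵢ with Cycle.vertex-endpoint {List.lookup D i} (decomp-cycles D-decomp i) v∈Cᵢ
    ... | e , e∈Cᵢ , inj₁ refl = proj₁ (closed {G} S e (decomp-⊆ D-decomp i e∈Cᵢ))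
    ... | e , e∈Cᵢ , inj₂ refl = proj₂ (closed {G} S e (decomp-⊆ D-decomp i e∈Cᵢ))

  partition⇒decomp : ∀ T D → (∀ i → IsCycle G (List.lookup D i)) → (∀ i → E {G} (List.lookup D i) ⊆ T) →
    (∀ e → e ∈ T → Σ _ λ i → e ∈ E {G} (List.lookup D i) × (∀ j → e ∈ E {G} (List.lookup D j) → j ≡ i)) →
    Decomp T D
  partition⇒decomp T [] _ _ covers = done λ { (e , e∈T) → no-index (covers e e∈T) }
    where
    no-index : ∀ {A : Fin 0 → Set} → Σ (Fin 0) A → False
    no-index (() , _)
  partition⇒decomp T (C ∷ D) cycles ⊆T covers =
    peel (cycles zero) (⊆T zero) (partition⇒decomp (T ─ E {G} C) D (cycles ∘ suc) rest-⊆ rest-covers)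
    where
    rest-⊆ : ∀ i → E {G} (List.lookup D i) ⊆ T ─ E {G} C
    rest-⊆ i e∈Cᵢ with covers _ (⊆T (suc i) e∈Cᵢ)
    ... | _ , _ , unique = SubP.x∈p∧x∉q⇒x∈p─q (⊆T (suc i) e∈Cᵢ)
                             (λ e∈C → zero≢suc (trans (unique zero e∈C) (sym (unique (suc i) e∈Cᵢ))))
      where
      zero≢suc : zero ≢ suc i
      zero≢suc ()
    rest-covers : ∀ e → e ∈ T ─ E {G} C →
      Σ _ λ i → e ∈ E {G} (List.lookup D i) × (∀ j → e ∈ E {G} (List.lookup D j) → j ≡ i)
    rest-covers e e∈ with covers e (SubP.p─q⊆p T _ e∈)
    ... | zero  , e∈C  , _      = ⊥-elim (∈─⇒∉ T _ e∈ e∈C)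
    ... | suc i , e∈Cᵢ , unique = i , e∈Cᵢ , λ j e∈Cⱼ → FinP.suc-injective (unique (suc j) e∈Cⱼ)

  fromCycleDecomp : ∀ (S : Sub G) {D} → CycleDecomp G S D → Decomp (E {G} S) D
  fromCycleDecomp S {D} (cycles , ≤S , covers) = partition⇒decomp (E {G} S) D cycles (proj₂ ∘ ≤S) covers

least-below : (P : ℕ → Set) → (∀ n → Dec (P n)) → ∀ k →
              (∀ n → n < k → ¬ P n) ⊎ Σ ℕ λ a → P a × (∀ n → P n → a ≤ n)
least-below P P? zero = inj₁ (λ n ())
least-below P P? (suc k) with least-below P P? k
... | inj₂ least = inj₂ least
... | inj₁ none-below with P? k
...   | yes Pk  = inj₂ (k , Pk , λ n Pn → ℕP.≮⇒≥ (λ n<k → none-below n n<k Pn))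
...   | no ¬Pk  = inj₁ none-below-suc
  where
  none-below-suc : ∀ n → n < suc k → ¬ P n
  none-below-suc n (s≤s n≤k) Pn with ℕP.m≤n⇒m<n∨m≡n n≤k
  ... | inj₁ n<k  = none-below n n<k Pn
  ... | inj₂ refl = ¬Pk Pn

least-witness : (P : ℕ → Set) → (∀ n → Dec (P n)) → ∀ m → P m →
                Σ ℕ λ a → P a × (∀ n → P n → a ≤ n)
least-witness P P? m Pm with least-below P P? (suc m)
... | inj₁ none-below = ⊥-elim (none-below m ℕP.≤-refl Pm)
... | inj₂ least      = least

greatest-witness : (P : ℕ → Set) → (∀ n → Dec (P n)) → ∀ B → (∀ n → P n → n ≤ B) → ∀ m → P m →
                   Σ ℕ λ b → P b × (∀ n → P n → n ≤ b)
greatest-witness P P? B bounded m Pm with P? B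
... | yes PB = B , PB , bounded
greatest-witness P P? zero    bounded m Pm | no ¬PB with ℕP.n≤0⇒n≡0 (bounded m Pm)
... | refl = ⊥-elim (¬PB Pm)
greatest-witness P P? (suc B) bounded m Pm | no ¬PB = greatest-witness P P? B bounded′ m Pm
  where
  bounded′ : ∀ n → P n → n ≤ B
  bounded′ n Pn with ℕP.m≤n⇒m<n∨m≡n (bounded n Pn)
  ... | inj₁ (s≤s n≤B) = n≤B
  ... | inj₂ refl      = ⊥-elim (¬PB Pn)

-- A cycle
-- edge set is a circuit (a minimal nonempty even set) and every circuit
-- is the edge set of a cycle, so "T splits into n cycles" is equivalent to
-- "T splits into n circuits", which is decidable by searching all subsets;
-- the number of pieces is at most |T|.

module Extremal (G : Graph) where
  open Parity G
  open Cycles G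
  open FindCycle G
  open Decompositions G

  Circuit : EdgeSet → Set
  Circuit U = Nonempty U × Even U × (∀ W → W ⊆ U → Nonempty W → Even W → U ⊆ W)

  Splits : EdgeSet → ℕ → Set
  Splits T zero    = Empty T
  Splits T (suc n) = Σ EdgeSet λ U → Circuit U × U ⊆ T × Splits (T ─ U) n

  even? : ∀ T → Dec (Even T)
  even? T = FinP.all? (λ v → deg T v BoolP.≟ false)

  circuit? : ∀ U → Dec (Circuit U)
  circuit? U = SubP.nonempty? U ×-dec even? U ×-dec minimal?
    where
    Smaller : EdgeSet → Set
    Smaller W = W ⊆ U × Nonempty W × Even W × ¬ (U ⊆ W)
    minimal? : Dec (∀ W → W ⊆ U → Nonempty W → Even W → U ⊆ W)
    minimal? with SubP.anySubset? {P = Smaller}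
                    (λ W → (W SubP.⊆? U) ×-dec SubP.nonempty? W ×-dec even? W ×-dec ¬? (U SubP.⊆? W))
    ... | yes (W , W⊆U , W-nonempty , W-even , U⊈W) = no (λ minimal → U⊈W (minimal W W⊆U W-nonempty W-even))
    ... | no no-smaller = yes minimal
      where
      minimal : ∀ W → W ⊆ U → Nonempty W → Even W → U ⊆ W
      minimal W W⊆U W-nonempty W-even with U SubP.⊆? W
      ... | yes U⊆W = U⊆W
      ... | no U⊈W  = ⊥-elim (no-smaller (W , W⊆U , W-nonempty , W-even , U⊈W))

  splits? : ∀ T n → Dec (Splits T n)
  splits? T zero    = ¬? (SubP.nonempty? T)
  splits? T (suc n) = SubP.anySubset? (λ U → circuit? U ×-dec (U SubP.⊆? T) ×-dec splits? (T ─ U) n)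

  cycle-circuit : ∀ {C} → IsCycle G C → Circuit (E {G} C)
  cycle-circuit {C} C-cycle = nonempty , even , minimal
    where open Cycle {C} C-cycle

  -- a circuit contains a cycle, which by minimality is all of it
  circuit-cycle : ∀ U → Circuit U → Σ (Sub G) λ C → IsCycle G C × E {G} C ≡ U
  circuit-cycle U (U-nonempty , U-even , U-minimal) with findCycle U U-even U-nonempty
  ... | C , C-cycle , C⊆U = C , C-cycle ,
    SubP.⊆-antisym C⊆U (U-minimal (E {G} C) C⊆U (Cycle.nonempty {C} C-cycle) (Cycle.even {C} C-cycle))

  decomp⇒splits : ∀ {T D} → Decomp T D → Splits T (length D)
  decomp⇒splits (done T-empty)                    = T-empty
  decomp⇒splits (peel {C = C} C-cycle C⊆T D-decomp) =
    E {G} C , cycle-circuit {C} C-cycle , C⊆T , decomp⇒splits D-decomp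

  splits⇒decomp : ∀ n T → Splits T n → Σ (List (Sub G)) λ D → Decomp T D × length D ≡ n
  splits⇒decomp zero    T T-empty = [] , done T-empty , refl
  splits⇒decomp (suc n) T (U , U-circuit , U⊆T , rest) =
    peel-circuit (circuit-cycle U U-circuit) (splits⇒decomp n (T ─ U) rest)
    where
    peel-circuit : (Σ (Sub G) λ C → IsCycle G C × E {G} C ≡ U) →
                   (Σ (List (Sub G)) λ D → Decomp (T ─ U) D × length D ≡ n) →
                   Σ (List (Sub G)) λ D → Decomp T D × length D ≡ suc n
    peel-circuit (C , C-cycle , C≡U) (D , D-decomp , length≡n) =
      C ∷ D , peel C-cycle (subst (_⊆ T) (sym C≡U) U⊆T) (subst (λ X → Decomp (T ─ X) D) (sym C≡U) D-decomp) ,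
      cong suc length≡n

  splits-bound : ∀ n T → Splits T n → n ≤ ∣ T ∣
  splits-bound zero    T _ = z≤n
  splits-bound (suc n) T (U , (U-nonempty , _) , U⊆T , rest) =
    ℕP.≤-<-trans (splits-bound n (T ─ U) rest)
      (SubP.p∩q≢∅⇒∣p─q∣<∣p∣ T U (proj₁ U-nonempty , SubP.x∈p∩q⁺ (U⊆T (proj₂ U-nonempty) , proj₂ U-nonempty)))

  module _ (S : Sub G) {D : List (Sub G)} (D-decomp : Decomp (E {G} S) D) where

    c-exists : Σ ℕ λ a → IsC G S a × a ≤ length D
    c-exists with least-witness (Splits (E {G} S)) (splits? (E {G} S)) (length D) (decomp⇒splits D-decomp)
    ... | a , a-splits , a-least with splits⇒decomp a (E {G} S) a-splits
    ...   | D₀ , D₀-decomp , length≡a =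
      a , ((D₀ , toCycleDecomp S D₀-decomp , length≡a) ,
           λ D′ D′-cd → a-least (length D′) (decomp⇒splits (fromCycleDecomp S {D′} D′-cd))) ,
      a-least (length D) (decomp⇒splits D-decomp)

    ν-exists : Σ ℕ λ b → IsNu G S b × length D ≤ b
    ν-exists with greatest-witness (Splits (E {G} S)) (splits? (E {G} S)) ∣ E {G} S ∣
                    (λ n → splits-bound n (E {G} S)) (length D) (decomp⇒splits D-decomp)
    ... | b , b-splits , b-greatest with splits⇒decomp b (E {G} S) b-splits
    ...   | D₀ , D₀-decomp , length≡b =
      b , ((D₀ , toCycleDecomp S D₀-decomp , length≡b) ,
           λ D′ D′-cd → b-greatest (length D′) (decomp⇒splits (fromCycleDecomp S {D′} D′-cd))) ,
      b-greatest (length D) (decomp⇒splits D-decomp)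

  ν-atLeast : ∀ (S : Sub G) {k} → AtLeast k (E {G} S) → Σ ℕ λ b → IsNu G S b × k ≤ b
  ν-atLeast S (D , D-decomp , k≤) with ν-exists S D-decomp
  ... | b , b-is-ν , length≤b = b , b-is-ν , ℕP.≤-trans k≤ length≤b

  c<ν : ∀ (S : Sub G) {D₁ D₂} → Decomp (E {G} S) D₁ → Decomp (E {G} S) D₂ →
        length D₁ < length D₂ → CLtNu G S
  c<ν S D₁-decomp D₂-decomp shorter with c-exists S D₁-decomp | ν-exists S D₂-decomp
  ... | a , a-is-c , a≤ | b , b-is-ν , ≤b =
    a , b , a-is-c , b-is-ν , ℕP.≤-<-trans a≤ (ℕP.<-≤-trans shorter ≤b)

-- Cutting each at x, y, z gives trails linking x–y, y–z and z–x in each;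
-- matching links of the two trails form three disjoint nonempty even sets,
-- so together the trails split into at least three cycles.

module ThreeVertices (G : Graph) where
  open Parity G
  open Walks G
  open Cycles G
  open Decompositions G

  atLeast-++ : ∀ xs ys {k l} → Unique (xs ++ ys) → AtLeast k (fromList xs) → AtLeast l (fromList ys) →
               AtLeast (k + l) (fromList (xs ++ ys))
  atLeast-++ xs ys {k} {l} xs++ys-unique (D , D-decomp , k≤) (D′ , D′-decomp , l≤) =
    D ++ D′ ,
    subst (λ X → Decomp X (D ++ D′)) (sym (fromList-++ xs ys)) (decomp-∪ D-decomp D′-decomp disjoint) ,
    subst (k + l ≤_) (sym (ListP.length-++ D)) (ℕP.+-mono-≤ k≤ l≤)
    where
    disjoint : ∀ e → e ∈ fromList xs → e ∉ fromList ys
    disjoint e e∈xs e∈ys =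
      proj₂ (proj₂ (unique-++⁻ xs xs++ys-unique)) (∈fromList⁻ xs e∈xs) (∈fromList⁻ ys e∈ys)

  two-links : ∀ {a b xs ys} → a ≢ b → Link a b xs → Link a b ys → Unique (xs ++ ys) →
              AtLeast 1 (fromList (xs ++ ys))
  two-links {a} {b} {xs} {ys} a≢b xs-link ys-link xs++ys-unique =
    decompose-nonempty (fromList (xs ++ ys)) even nonempty
    where
    pieces = unique-++⁻ xs xs++ys-unique
    even : Even (fromList (xs ++ ys))
    even v = begin
      deg (fromList (xs ++ ys)) v                     ≡⟨ cong (λ X → deg X v) (fromList-++ xs ys) ⟩
      deg (fromList xs ∪ fromList ys) v               ≡⟨ deg-∪ (fromList xs) (fromList ys) disjoint v ⟩
      deg (fromList xs) v xor deg (fromList ys) v     ≡⟨ cong₂ _xor_ (link-deg xs-link (proj₁ pieces) v)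
                                                                     (link-deg ys-link (proj₁ (proj₂ pieces)) v) ⟩
      ends a b v xor ends a b v                       ≡⟨ BoolP.xor-same (ends a b v) ⟩
      false                                           ∎
      where
      open ≡-Reasoning
      disjoint : ∀ e → e ∈ fromList xs → e ∉ fromList ys
      disjoint e e∈xs e∈ys = proj₂ (proj₂ pieces) (∈fromList⁻ xs e∈xs) (∈fromList⁻ ys e∈ys)
    nonempty : Nonempty (fromList (xs ++ ys))
    nonempty with boundary⇒nonempty (fromList xs) a b a≢b (link-deg xs-link (proj₁ pieces))
    ... | e , e∈xs = e , ∈fromList⁺ (xs ++ ys) (ListMemP.∈-++⁺ˡ (∈fromList⁻ xs e∈xs))

  three-cycles : ∀ {a b x y z es fs} → x ≢ y → x ≢ z → y ≢ z →
                 (W : Walk G a a es) (W′ : Walk G b b fs) → Unique (es ++ fs) →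
                 Visits W x → Visits W y → Visits W z → Visits W′ x → Visits W′ y → Visits W′ z →
                 AtLeast 3 (fromList (es ++ fs))
  three-cycles {es = es} {fs} x≢y x≢z y≢z W W′ es++fs-unique x∈W y∈W z∈W x∈W′ y∈W′ z∈W′ =
    atLeast-resp (fromList-resp-↭ matched↭)
      (atLeast-++ L₁ (L₂ ++ L₃) matched-unique (two-links x≢y link₁ link₁′ L₁-unique)
        (atLeast-++ L₂ L₃ L₂₃-unique (two-links y≢z link₂ link₂′ L₂-unique)
                                     (two-links (x≢z ∘ sym) link₃ link₃′ L₃-unique)))
    where
    open ThreeArcs (threeArcs W x∈W y∈W z∈W)
    open ThreeArcs (threeArcs W′ x∈W′ y∈W′ z∈W′) renaming
      (arc₁ to arc₁′; arc₂ to arc₂′; arc₃ to arc₃′; link₁ to link₁′; link₂ to link₂′; link₃ to link₃′; arcs↭ to arcs↭′)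
    -- match the arcs of W and W′ with the same ends
    L₁ = arc₁ ++ arc₁′
    L₂ = arc₂ ++ arc₂′
    L₃ = arc₃ ++ arc₃′
    matched↭ : L₁ ++ (L₂ ++ L₃) ↭ es ++ fs
    matched↭ = begin
      L₁ ++ (L₂ ++ L₃)                                   ↭⟨ PermP.++⁺ˡ L₁ (↭-interchange arc₂ arc₂′ arc₃ arc₃′) ⟩
      L₁ ++ ((arc₂ ++ arc₃) ++ (arc₂′ ++ arc₃′))         ↭⟨ ↭-interchange arc₁ arc₁′ (arc₂ ++ arc₃) (arc₂′ ++ arc₃′) ⟩
      (arc₁ ++ arc₂ ++ arc₃) ++ (arc₁′ ++ arc₂′ ++ arc₃′) ↭⟨ PermP.++⁺ arcs↭ arcs↭′ ⟩
      es ++ fs                                           ∎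
      where open PermutationReasoning
    matched-unique : Unique (L₁ ++ (L₂ ++ L₃))
    matched-unique = unique-resp-↭ (↭-sym matched↭) es++fs-unique
    L₁-unique : Unique L₁
    L₁-unique = proj₁ (unique-++⁻ L₁ matched-unique)
    L₂₃-unique : Unique (L₂ ++ L₃)
    L₂₃-unique = proj₁ (proj₂ (unique-++⁻ L₁ matched-unique))
    L₂-unique : Unique L₂
    L₂-unique = proj₁ (unique-++⁻ L₂ L₂₃-unique)
    L₃-unique : Unique L₃
    L₃-unique = proj₁ (proj₂ (unique-++⁻ L₂ L₂₃-unique))

-- Their edge set is even and splits as
-- [C₁, C₂]; no single cycle covers it (it would be a proper even subset
-- containing E C₁, against minimality); and when the cycles share three
-- vertices it splits into at least three cycles.

module CyclePair (G : Graph) {C₁ C₂ : Sub G} (C₁-cycle : IsCycle G C₁) (C₂-cycle : IsCycle G C₂)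
                 (disjoint : EdgeDisjoint G C₁ C₂) where
  open Parity G
  open Cycles G
  open Decompositions G
  open ThreeVertices G
  module Cycle₁ = Cycle {C₁} C₁-cycle
  module Cycle₂ = Cycle {C₂} C₂-cycle

  Both : EdgeSet
  Both = E {G} C₁ ∪ E {G} C₂

  both-even : Even Both
  both-even = even-∪ (E {G} C₁) (E {G} C₂) disjoint Cycle₁.even Cycle₂.even

  single : ∀ {C} → IsCycle G C → Decomp (E {G} C) (C ∷ [])
  single {C} C-cycle = peel C-cycle (λ e∈C → e∈C) (done λ { (e , e∈) → ∈─⇒∉ (E {G} C) _ e∈ (SubP.p─q⊆p (E {G} C) _ e∈) })

  pair-decomp : Decomp Both (C₁ ∷ C₂ ∷ [])
  pair-decomp = decomp-∪ (single C₁-cycle) (single C₂-cycle) disjoint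

  at-least-two : ∀ {D} → Decomp Both D → 2 ≤ length D
  at-least-two (done Both-empty) =
    ⊥-elim (Both-empty (proj₁ Cycle₁.nonempty , SubP.p⊆p∪q (E {G} C₂) (proj₂ Cycle₁.nonempty)))
  at-least-two (peel {C = C} C-cycle C⊆Both (done rest-empty)) =
    ⊥-elim (disjoint e₂ (C⊆C₁ (Both⊆C (SubP.q⊆p∪q (E {G} C₁) _ e₂∈C₂))) e₂∈C₂)
    where
    e₂ = proj₁ Cycle₂.nonempty
    e₂∈C₂ = proj₂ Cycle₂.nonempty
    Both⊆C : Both ⊆ E {G} C
    Both⊆C {e} e∈ with e SubP.∈? E {G} C
    ... | yes e∈C = e∈C
    ... | no e∉C  = ⊥-elim (rest-empty (e , SubP.x∈p∧x∉q⇒x∈p─q e∈ e∉C))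
    C⊆C₁ : E {G} C ⊆ E {G} C₁
    C⊆C₁ = Cycle.minimal {C} C-cycle (E {G} C₁) (Both⊆C ∘ SubP.p⊆p∪q (E {G} C₂)) Cycle₁.nonempty Cycle₁.even
  at-least-two (peel _ _ (peel _ _ _)) = s≤s (s≤s z≤n)

  three-decomp : ShareMoreThanTwo G C₁ C₂ → AtLeast 3 Both
  three-decomp (x , y , z , x≢y , x≢z , y≢z , x∈C₁ , y∈C₁ , z∈C₁ , x∈C₂ , y∈C₂ , z∈C₂) =
    atLeast-resp edges
      (three-cycles x≢y x≢z y≢z Cycle₁.walk Cycle₂.walk edgeLists-unique
        (Cycle₁.visits x∈C₁) (Cycle₁.visits y∈C₁) (Cycle₁.visits z∈C₁)
        (Cycle₂.visits x∈C₂) (Cycle₂.visits y∈C₂) (Cycle₂.visits z∈C₂))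
    where
    edgeLists-unique : Unique (Cycle₁.edgeList ++ Cycle₂.edgeList)
    edgeLists-unique = UniqueP.++⁺ Cycle₁.edgeList-unique Cycle₂.edgeList-unique λ (e∈₁ , e∈₂) →
      disjoint _ (subst (_ ∈_) Cycle₁.edgeList-set (∈fromList⁺ _ e∈₁))
                 (subst (_ ∈_) Cycle₂.edgeList-set (∈fromList⁺ _ e∈₂))
    edges : fromList (Cycle₁.edgeList ++ Cycle₂.edgeList) ≡ Both
    edges = trans (fromList-++ Cycle₁.edgeList Cycle₂.edgeList)
                  (cong₂ _∪_ Cycle₁.edgeList-set Cycle₂.edgeList-set)

-- If G is even and an even edge set T has decompositions of different
-- sizes, so does G: extend both by one decomposition of the (even)
-- remaining edges.

module WholeGraph (G : Graph) where
  open Parity G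
  open Decompositions G
  open Extremal G

  c<ν-from-part : ∀ T {D₁ D₂} → Even ⊤ → Even T → Decomp T D₁ → Decomp T D₂ →
                  length D₁ < length D₂ → CLtNu G (full G)
  c<ν-from-part T {D₁} {D₂} G-even T-even D₁-decomp D₂-decomp shorter =
    with-rest (decompose (⊤ ─ T) (even-─ ⊤ T (λ _ → SubP.∈⊤) G-even T-even))
    where
    with-rest : Σ (List (Sub G)) (Decomp (⊤ ─ T)) → CLtNu G (full G)
    with-rest (R , R-decomp) = c<ν (full G) (extend D₁-decomp) (extend D₂-decomp) longer
      where
      extend : ∀ {D} → Decomp T D → Decomp ⊤ (D ++ R)
      extend D-decomp = subst (λ X → Decomp X _)
        (trans (SubP.∪-comm T (⊤ ─ T)) (─-∪-cancel ⊤ T SubP.⊆⊤))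
        (decomp-∪ D-decomp R-decomp (λ e e∈T e∈R → ∈─⇒∉ ⊤ T e∈R e∈T))
      longer : length (D₁ ++ R) < length (D₂ ++ R)
      longer rewrite ListP.length-++ D₁ {R} | ListP.length-++ D₂ {R} = ℕP.+-monoˡ-< (length R) shorter

mainTheorem13 : ((G : Graph) (H : Sub G) → Eulerian G (full G) → Eulerian G H →
    CLtNu G H → CLtNu G (full G)) ×
    ((H' : Graph) (C₁ C₂ : Sub H') → IsCycle H' C₁ → IsCycle H' C₂ →
    EdgeDisjoint H' C₁ C₂ →
    (∀ e → (e ∈ E {H'} C₁) ⊎ (e ∈ E {H'} C₂)) →
    ShareMoreThanTwo H' C₁ C₂ →
    IsC H' (full H') 2 × Σ ℕ (λ b → IsNu H' (full H') b × 3 ≤ b)) ×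
    ((G : Graph) (C₁ C₂ : Sub G) → Eulerian G (full G) →
    IsCycle G C₁ → IsCycle G C₂ → EdgeDisjoint G C₁ C₂ →
    ShareMoreThanTwo G C₁ C₂ → CLtNu G (full G))
mainTheorem13 = part-i , part-ii , in-particular
  where
  part-i : (G : Graph) (H : Sub G) → Eulerian G (full G) → Eulerian G H → CLtNu G H → CLtNu G (full G)
  part-i G H G-eulerian H-eulerian (a , b , ((Da , Da-cd , refl) , _) , ((Db , Db-cd , refl) , _) , a<b) =
    c<ν-from-part (E {G} H) (eulerian⇒even (full G) G-eulerian) (eulerian⇒even H H-eulerian)
      (fromCycleDecomp H {Da} Da-cd) (fromCycleDecomp H {Db} Db-cd) a<b
    where
    open Parity G
    open Decompositions G
    open WholeGraph G

  part-ii : (H′ : Graph) (C₁ C₂ : Sub H′) → IsCycle H′ C₁ → IsCycle H′ C₂ → EdgeDisjoint H′ C₁ C₂ →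
            (∀ e → (e ∈ E {H′} C₁) ⊎ (e ∈ E {H′} C₂)) → ShareMoreThanTwo H′ C₁ C₂ →
            IsC H′ (full H′) 2 × Σ ℕ (λ b → IsNu H′ (full H′) b × 3 ≤ b)
  part-ii H′ C₁ C₂ C₁-cycle C₂-cycle disjoint covers share =
    ((C₁ ∷ C₂ ∷ [] , toCycleDecomp (full H′) (subst (λ X → Decomp X (C₁ ∷ C₂ ∷ [])) Both≡⊤ pair-decomp) , refl) ,
     λ D D-cd → at-least-two (subst (λ X → Decomp X D) (sym Both≡⊤) (fromCycleDecomp (full H′) {D} D-cd))) ,
    ν-atLeast (full H′) (atLeast-resp Both≡⊤ (three-decomp share))
    where
    open Decompositions H′
    open Extremal H′
    open CyclePair H′ {C₁} {C₂} C₁-cycle C₂-cycle disjoint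
    Both≡⊤ : Both ≡ ⊤
    Both≡⊤ = SubP.⊆-antisym SubP.⊆⊤ (λ {e} _ → SubP.x∈p∪q⁺ (covers e))

  -- in particular: the argument of (i) applies to the even set E C₁ ∪ E C₂
  in-particular : (G : Graph) (C₁ C₂ : Sub G) → Eulerian G (full G) → IsCycle G C₁ → IsCycle G C₂ →
                  EdgeDisjoint G C₁ C₂ → ShareMoreThanTwo G C₁ C₂ → CLtNu G (full G)
  in-particular G C₁ C₂ G-eulerian C₁-cycle C₂-cycle disjoint share = from-three (three-decomp share)
    where
    open Parity G
    open Decompositions G
    open CyclePair G {C₁} {C₂} C₁-cycle C₂-cycle disjoint
    open WholeGraph G
    from-three : AtLeast 3 Both → CLtNu G (full G)
    from-three (D , D-decomp , three≤) =
      c<ν-from-part Both (eulerian⇒even (full G) G-eulerian) both-even pair-decomp D-decomp three≤
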